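{- For any two rooted binary trees $S$ and $T$ on the vertex set $\{1,\dots,n\}$ ($n\ge 1$), each labeled in infix order, the chain distance satisfies $C(S,T) \le n-1$.
   Context: Trees are rooted binary trees whose $n$ vertices are identified with $1,\dots,n$ in infix (in-order) order. A subtree rooted at $x$ is $x$ together with all its descendants. A left chain $[u$-$v]$ is a nonempty sequence of vertices $u=x_1,\dots,x_k=v$ with $x_{i+1}$ the left child of $x_i$; right chains are defined symmetrically. A direct c-rotation $\mathrm{rot}([u$-$v],w)$ applies when $[u$-$v]$ is a left chain and $u$ is the right child of $w$. Its effect: (i) $u$ takes the place of $w$ (as the child of $w$'s former parent on the same side, or as the root); (ii) $w$ becomes the left child of $v$; (iii) the former left subtree of $v$, if any, becomes the right subtree of $w$ (else $w$'s right child is empty). An inverse c-rotation $\mathrm{rot}(w,[u$-$v])$ applies when $[u$-$v]$ is a left chain and $w$ is the left child of $v$. Its effect: (i) $w$ takes the place of $u$; (ii) $u$ becomes the right child of $w$; (iii) the former right subtree of $w$, if any, becomes the left subtree of $v$ (else $v$'s left child is empty). The mirror-image operations for right chains (interchanging left and right) are also c-rotations. All other pointers are unchanged by a c-rotation. The chain distance $C(S,T)$ is the minimum number of c-rotations needed to transform $S$ into $T$. -}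

module Defs where

open import Data.Nat using (ℕ; zero; suc; _+_)
open import Data.List using (List; []; _∷_)

-- Rooted binary trees (shapes). A tree with n nodes has its vertices
-- implicitly labelled 1..n in infix (in-order) order, so the shape
-- determines the labelled tree.
data Tree : Set where
  leaf : Tree
  node : Tree → Tree → Tree

size : Tree → ℕ
size leaf       = 0
size (node l r) = suc (size l + size r)

-- plugL R₁ [R₂ … R_k] B : the subtree rooted at the top u = x₁ of a
-- (nonempty) left chain [u-v] = x₁,…,x_k, where x_i has right subtree R_i
-- and v = x_k has left subtree B.
plugL : Tree → List Tree → Tree → Tree
plugL R []        B = node B R
plugL R (R′ ∷ Rs) B = node (plugL R′ Rs B) R

-- Mirror image: a nonempty right chain x₁,…,x_k, x_i with left subtree L_i,
-- v = x_k with right subtree B.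
plugR : Tree → List Tree → Tree → Tree
plugR L []        B = node L B
plugR L (L′ ∷ Ls) B = node L (plugR L′ Ls B)

infix 4 _⟶_
data _⟶_ : Tree → Tree → Set where
  -- direct rot([u-v],w): w = node A (chain), afterwards w = node A B is
  -- the left child of v and u takes w's place
  dirL : ∀ A R Rs B → node A (plugL R Rs B) ⟶ plugL R Rs (node A B)
  -- inverse rot(w,[u-v]): w = node A B is the left child of v
  invL : ∀ A R Rs B → plugL R Rs (node A B) ⟶ node A (plugL R Rs B)
  dirR : ∀ A L Ls B → node (plugR L Ls B) A ⟶ plugR L Ls (node B A)
  invR : ∀ A L Ls B → plugR L Ls (node B A) ⟶ node (plugR L Ls B) A
  inL  : ∀ {S S′} T → S ⟶ S′ → node S T ⟶ node S′ T
  inR  : ∀ S {T T′} → T ⟶ T′ → node S T ⟶ node S T′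

data Rots : ℕ → Tree → Tree → Set where
  done : ∀ {S} → Rots zero S S
  step : ∀ {k S S′ T} → S ⟶ S′ → Rots k S′ T → Rots (suc k) S T

-- C(S,T) ≤ m : S can be transformed into T by at most m c-rotations
-- (equivalent to the minimum C(S,T) being ≤ m).
open import Data.Product using (Σ; _×_)
open import Data.Nat using (_≤_)

ChainDist≤ : Tree → Tree → ℕ → Set
ChainDist≤ S T m = Σ ℕ (λ k → k ≤ m × Rots k S T)

-- Move a gap (a leaf position) through both trees from right to left, keeping S and
-- T in agreement to the right of the gap: the same vertices lie there, as the
-- left-turning ancestors of the gap, with the same right subtrees. From the vertex w
-- just left of the gap, the path to the gap turns right once and then runs down a
-- left chain made of the lowest few of those ancestors; if the two trees use chains
-- of different lengths, one c-rotation moving w down the longer chain equalises them.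
-- So each vertex costs at most one c-rotation, except vertex n, whose right subtree
-- is empty in both trees.
module Submission where

open import Defs
open import Data.Nat using (ℕ; _∸_; _≥_; zero; suc; _+_; z≤n; s≤s)
open import Data.Nat.Properties using (suc-injective; m≤n⇒m≤1+n; +-identityʳ)
open import Data.Nat.Tactic.RingSolver using (solve-∀)
open import Data.List using (List; []; _∷_; _++_; foldr)
open import Data.List.Properties using (foldr-++; ++-assoc; ++-identityʳ; ∷-injective)
open import Data.Product using (∃₂; _×_; _,_)
open import Data.Sum using (_⊎_; inj₁; inj₂)
open import Function using (flip; _∘_)
open import Relation.Binary.PropositionalEquality
  using (_≡_; refl; sym; trans; cong; subst₂)

⟶-sym : ∀ {S T} → S ⟶ T → T ⟶ S
⟶-sym (dirL A R Rs B) = invL A R Rs B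
⟶-sym (invL A R Rs B) = dirL A R Rs B
⟶-sym (dirR A L Ls B) = invR A L Ls B
⟶-sym (invR A L Ls B) = dirR A L Ls B
⟶-sym (inL T s)       = inL T (⟶-sym s)
⟶-sym (inR S s)       = inR S (⟶-sym s)

Rots-snoc : ∀ {k S U T} → Rots k S U → U ⟶ T → Rots (suc k) S T
Rots-snoc done        s = step s done
Rots-snoc (step r rs) s = step r (Rots-snoc rs s)

Rots-reverse : ∀ {k S T} → Rots k S T → Rots k T S
Rots-reverse done        = done
Rots-reverse (step s rs) = Rots-snoc (Rots-reverse rs) (⟶-sym s)

ChainDist≤-refl : ∀ {S m} → ChainDist≤ S S m
ChainDist≤-refl = 0 , z≤n , done

ChainDist≤-sym : ∀ {S T m} → ChainDist≤ S T m → ChainDist≤ T S m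
ChainDist≤-sym (k , k≤m , rs) = k , k≤m , Rots-reverse rs

ChainDist≤-step : ∀ {S S′ T m} → S ⟶ S′ → ChainDist≤ S′ T m → ChainDist≤ S T (suc m)
ChainDist≤-step s (k , k≤m , rs) = suc k , s≤s k≤m , step s rs

ChainDist≤-suc : ∀ {S T m} → ChainDist≤ S T m → ChainDist≤ S T (suc m)
ChainDist≤-suc (k , k≤m , rs) = k , m≤n⇒m≤1+n k≤m , rs

++-≡-++ : ∀ {A : Set} (xs ys as bs : List A) → xs ++ as ≡ ys ++ bs →
  (xs ≡ ys × as ≡ bs) ⊎
  (∃₂ λ w ws → ys ≡ xs ++ w ∷ ws × as ≡ w ∷ ws ++ bs) ⊎
  (∃₂ λ w ws → xs ≡ ys ++ w ∷ ws × bs ≡ w ∷ ws ++ as)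
++-≡-++ []       []       as bs e = inj₁ (refl , e)
++-≡-++ []       (y ∷ ys) as bs e = inj₂ (inj₁ (y , ys , refl , e))
++-≡-++ (x ∷ xs) []       as bs e = inj₂ (inj₂ (x , xs , refl , sym e))
++-≡-++ (x ∷ xs) (y ∷ ys) as bs e with ∷-injective e
... | refl , e′ with ++-≡-++ xs ys as bs e′
...   | inj₁ (p , q)                 = inj₁ (cong (x ∷_) p , q)
...   | inj₂ (inj₁ (w , ws , p , q)) = inj₂ (inj₁ (w , ws , cong (x ∷_) p , q))
...   | inj₂ (inj₂ (w , ws , p , q)) = inj₂ (inj₂ (w , ws , cong (x ∷_) p , q))

-- A left chain given top-down by the right subtrees of its vertices, ending in t.
leftChain : List Tree → Tree → Tree
leftChain Rs t = foldr (flip node) t Rs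

leftChain-++ : ∀ Rs Qs t → leftChain (Rs ++ Qs) t ≡ leftChain Rs (leftChain Qs t)
leftChain-++ Rs Qs t = foldr-++ (flip node) t Rs Qs

plugL≡leftChain : ∀ R Rs t → plugL R Rs t ≡ leftChain (R ∷ Rs) t
plugL≡leftChain R []        t = refl
plugL≡leftChain R (R′ ∷ Rs) t = cong (flip node R) (plugL≡leftChain R′ Rs t)

leftChain-⟶ : ∀ Rs {S S′} → S ⟶ S′ → leftChain Rs S ⟶ leftChain Rs S′
leftChain-⟶ []       s = s
leftChain-⟶ (R ∷ Rs) s = inL R (leftChain-⟶ Rs s)

chainRotation : ∀ A W Ws B →
  node A (leftChain (W ∷ Ws) B) ⟶ leftChain (W ∷ Ws) (node A B)
chainRotation A W Ws B =
  subst₂ _⟶_ (cong (node A) (plugL≡leftChain W Ws B)) (plugL≡leftChain W Ws (node A B))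
    (dirL A W Ws B)

-- A gap is a leaf position, recorded by the path to it from the root. The path
-- from `top Rs` is a left chain; `stepRight g L Rs` continues g by a vertex with
-- left subtree L, a step to its right child, and then a left chain. The part of the
-- tree to the right of the gap consists of the left-turning ancestors of the gap and
-- their right subtrees, so it is determined by `rightSide`, which lists these
-- subtrees top-down; `position` counts the vertices to the left of the gap.
data Gap : Set where
  top       : List Tree → Gap
  stepRight : Gap → Tree → List Tree → Gap

plug : Gap → Tree → Tree
plug (top Rs)           t = leftChain Rs t
plug (stepRight g L Rs) t = plug g (node L (leftChain Rs t))

fill : Gap → Tree
fill g = plug g leaf

rightSide : Gap → List Tree
rightSide (top Rs)           = Rs
rightSide (stepRight g L Rs) = rightSide g ++ Rs

position : Gap → ℕ
position (top _)           = 0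
position (stepRight g L _) = suc (position g + size L)

plug-⟶ : ∀ g {S S′} → S ⟶ S′ → plug g S ⟶ plug g S′
plug-⟶ (top Rs)           s = leftChain-⟶ Rs s
plug-⟶ (stepRight g L Rs) s = plug-⟶ g (inR L (leftChain-⟶ Rs s))

descendLeft : Gap → List Tree → Gap
descendLeft (top Rs)           Qs = top (Rs ++ Qs)
descendLeft (stepRight g L Rs) Qs = stepRight g L (Rs ++ Qs)

plug-descendLeft : ∀ g Qs t → plug (descendLeft g Qs) t ≡ plug g (leftChain Qs t)
plug-descendLeft (top Rs)           Qs t = leftChain-++ Rs Qs t
plug-descendLeft (stepRight g L Rs) Qs t = cong (plug g ∘ node L) (leftChain-++ Rs Qs t)

rightSide-descendLeft : ∀ g Qs → rightSide (descendLeft g Qs) ≡ rightSide g ++ Qs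
rightSide-descendLeft (top Rs)           Qs = refl
rightSide-descendLeft (stepRight g L Rs) Qs = sym (++-assoc (rightSide g) Rs Qs)

position-descendLeft : ∀ g Qs → position (descendLeft g Qs) ≡ position g
position-descendLeft (top Rs)           Qs = refl
position-descendLeft (stepRight g L Rs) Qs = refl

descendRight : Gap → Tree → Gap
descendRight g leaf       = g
descendRight g (node l r) = descendRight (stepRight g l []) r

fill-descendRight : ∀ g t → fill (descendRight g t) ≡ plug g t
fill-descendRight g leaf       = refl
fill-descendRight g (node l r) = fill-descendRight (stepRight g l []) r

rightSide-descendRight : ∀ g t → rightSide (descendRight g t) ≡ rightSide g
rightSide-descendRight g leaf       = refl
rightSide-descendRight g (node l r) =
  trans (rightSide-descendRight (stepRight g l []) r) (++-identityʳ (rightSide g))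

position-descendRight : ∀ g t → position (descendRight g t) ≡ position g + size t
position-descendRight g leaf       = sym (+-identityʳ (position g))
position-descendRight g (node l r) =
  trans (position-descendRight (stepRight g l []) r) (shift (position g) (size l) (size r))
  where
  shift : ∀ p l r → suc (p + l) + r ≡ p + suc (l + r)
  shift = solve-∀

-- The gap directly to the left of the vertex `node L X` plugged into g.
passVertex : Gap → Tree → Tree → Gap
passVertex g L X = descendRight (descendLeft g (X ∷ [])) L

fill-passVertex : ∀ g L X → fill (passVertex g L X) ≡ plug g (node L X)
fill-passVertex g L X =
  trans (fill-descendRight (descendLeft g (X ∷ [])) L) (plug-descendLeft g (X ∷ []) L)

rightSide-passVertex : ∀ g L X → rightSide (passVertex g L X) ≡ rightSide g ++ X ∷ []
rightSide-passVertex g L X =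
  trans (rightSide-descendRight (descendLeft g (X ∷ [])) L) (rightSide-descendLeft g (X ∷ []))

position-passVertex : ∀ g L X → position (passVertex g L X) ≡ position g + size L
position-passVertex g L X =
  trans (position-descendRight (descendLeft g (X ∷ [])) L)
        (cong (_+ size L) (position-descendLeft g (X ∷ [])))

shortenChain : ∀ g L W Ws Rs →
  fill (stepRight g L (W ∷ Ws ++ Rs)) ⟶ fill (stepRight (descendLeft g (W ∷ Ws)) L Rs)
shortenChain g L W Ws Rs =
  subst₂ _⟶_
    (cong (plug g ∘ node L) (sym (leftChain-++ (W ∷ Ws) Rs leaf)))
    (sym (plug-descendLeft g (W ∷ Ws) (node L (leftChain Rs leaf))))
    (plug-⟶ g (chainRotation L W Ws (leftChain Rs leaf)))

mutual
  sweep : ∀ m g h → rightSide g ≡ rightSide h → position g ≡ m → position h ≡ m →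
          ChainDist≤ (fill g) (fill h) m
  sweep zero (top Rs) (top .Rs) refl _ _ = ChainDist≤-refl
  sweep (suc m) (stepRight g L Rs) (stepRight h L′ Rs′) e i j
    with ++-≡-++ (rightSide g) (rightSide h) Rs Rs′ e
  ... | inj₁ (e′ , refl) =
    ChainDist≤-suc (sameChain m g L h L′ Rs e′ (suc-injective i) (suc-injective j))
  ... | inj₂ (inj₁ (W , Ws , e′ , refl)) =
    longerChain m g L h L′ W Ws Rs′ (sym e′) (suc-injective i) (suc-injective j)
  ... | inj₂ (inj₂ (W , Ws , e′ , refl)) =
    ChainDist≤-sym (longerChain m h L′ g L W Ws Rs (sym e′) (suc-injective j) (suc-injective i))

  sameChain : ∀ m g L h L′ Rs → rightSide g ≡ rightSide h →
              position g + size L ≡ m → position h + size L′ ≡ m →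
              ChainDist≤ (fill (stepRight g L Rs)) (fill (stepRight h L′ Rs)) m
  sameChain m g L h L′ Rs e i j =
    subst₂ (λ S T → ChainDist≤ S T m) (fill-passVertex g L X) (fill-passVertex h L′ X)
      (sweep m (passVertex g L X) (passVertex h L′ X)
        (trans (rightSide-passVertex g L X)
          (trans (cong (_++ X ∷ []) e) (sym (rightSide-passVertex h L′ X))))
        (trans (position-passVertex g L X) i)
        (trans (position-passVertex h L′ X) j))
    where
    X = leftChain Rs leaf

  longerChain : ∀ m g L h L′ W Ws Rs → rightSide g ++ W ∷ Ws ≡ rightSide h →
                position g + size L ≡ m → position h + size L′ ≡ m →
                ChainDist≤ (fill (stepRight g L (W ∷ Ws ++ Rs))) (fill (stepRight h L′ Rs)) (suc m)
  longerChain m g L h L′ W Ws Rs e i j =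
    ChainDist≤-step (shortenChain g L W Ws Rs)
      (sameChain m (descendLeft g (W ∷ Ws)) L h L′ Rs
        (trans (rightSide-descendLeft g (W ∷ Ws)) e)
        (trans (cong (_+ size L) (position-descendLeft g (W ∷ Ws))) i)
        j)

-- The gap directly to the left of the last vertex of `node l r` plugged into g.
lastGap : Gap → Tree → Tree → Gap
lastGap g l leaf       = passVertex g l leaf
lastGap g l (node a b) = lastGap (stepRight g l []) a b

fill-lastGap : ∀ g l r → fill (lastGap g l r) ≡ plug g (node l r)
fill-lastGap g l leaf       = fill-passVertex g l leaf
fill-lastGap g l (node a b) = fill-lastGap (stepRight g l []) a b

rightSide-lastGap : ∀ g l r → rightSide (lastGap g l r) ≡ rightSide g ++ leaf ∷ []
rightSide-lastGap g l leaf       = rightSide-passVertex g l leaf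
rightSide-lastGap g l (node a b) =
  trans (rightSide-lastGap (stepRight g l []) a b)
        (cong (_++ leaf ∷ []) (++-identityʳ (rightSide g)))

position-lastGap : ∀ g l r → position (lastGap g l r) ≡ position g + (size l + size r)
position-lastGap g l leaf       =
  trans (position-passVertex g l leaf) (cong (position g +_) (sym (+-identityʳ (size l))))
position-lastGap g l (node a b) =
  trans (position-lastGap (stepRight g l []) a b)
        (shift (position g) (size l) (size a) (size b))
  where
  shift : ∀ p l a b → suc (p + l) + (a + b) ≡ p + (l + suc (a + b))
  shift = solve-∀

proposition4 : (n : ℕ) → n ≥ 1 → (S T : Tree) → size S ≡ n → size T ≡ n →
    ChainDist≤ S T (n ∸ 1)
proposition4 .(size (node l r)) _ (node l r) (node a b) refl eT =
  subst₂ (λ S T → ChainDist≤ S T (size l + size r))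
    (fill-lastGap (top []) l r) (fill-lastGap (top []) a b)
    (sweep (size l + size r) (lastGap (top []) l r) (lastGap (top []) a b)
      (trans (rightSide-lastGap (top []) l r) (sym (rightSide-lastGap (top []) a b)))
      (position-lastGap (top []) l r)
      (trans (position-lastGap (top []) a b) (suc-injective eT)))
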